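{- Every cycle $C_n$ ($n\ge 3$) belongs to $\mathcal{C}_{\mathcal{P}\mathcal{S}}\setminus\mathcal{C}_{\mathcal{P}}$.
   Context: Graphs are finite and simple; $d(v)$ is degree. An orientation is $T$-odd if every vertex $v$ has odd in-degree iff $v\in T$; acyclic means no directed cycle. $Source(T)=V(G)\setminus T$, $Sink(T)=\{v\in T: d(v)\text{ odd}\}\cup\{v\notin T: d(v)\text{ even}\}$. $(\mathcal{P})$: $|E(G)|+|T|$ even. $(\mathcal{S})$: $Source(T)\neq\emptyset$ and if $|Source(T)|=1$ then $|V(G)|=1$ or $Source(T)\neq Sink(T)$. $\mathcal{C}_{\mathcal{P}}$ (resp. $\mathcal{C}_{\mathcal{P}\mathcal{S}}$) is the class of graphs $G$ admitting an acyclic $T$-odd orientation for every $T\subseteq V(G)$ satisfying $\mathcal{P}$ (resp. both $\mathcal{P}$ and $\mathcal{S}$). -}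

module Defs where

open import Data.Nat using (ℕ; zero; suc; _+_; _%_; _<ᵇ_; _≤_; NonZero; _≟_)
open import Data.Bool using (Bool; true; false; not; _∧_; _∨_; if_then_else_)
open import Data.Fin using (Fin; toℕ)
open import Data.Fin.Subset using (Subset; _∈_; _∉_; ∁; ∣_∣)
open import Data.Vec using (tabulate)
import Data.Vec
open import Data.Sum using (_⊎_; inj₁; inj₂)
open import Data.Empty using (⊥; ⊥-elim)
open import Data.Bool.Properties using (∨-comm)
open import Data.Nat using (_<_)
open import Data.Nat.Properties using (m≤n⇒m<n∨m≡n; 1+n≢n)
open import Data.Nat.DivMod using (m<n⇒m%n≡m; n%n≡0)
open import Data.Fin.Properties using (toℕ<n)
open import Relation.Nullary using (yes; no; Dec)
open import Relation.Binary.PropositionalEquality using (refl; cong) renaming (sym to ≡-sym; trans to ≡-trans)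
open import Data.List using (List; []; _∷_; map; allFin)
open import Data.Nat.ListAction using (sum)
open import Data.Product using (Σ; _×_; _,_; ∃)
open import Relation.Nullary using (¬_; does)
open import Relation.Binary.PropositionalEquality using (_≡_; _≢_)

Even : ℕ → Set
Even m = m % 2 ≡ 0

Odd : ℕ → Set
Odd m = m % 2 ≡ 1

oddᵇ : ℕ → Bool
oddᵇ m = does (m % 2 ≟ 1)

countF : {n : ℕ} → (Fin n → Bool) → ℕ
countF {n} p = sum (map (λ i → if p i then 1 else 0) (allFin n))

record Graph : Set where
  field
    n     : ℕ
    adj   : Fin n → Fin n → Bool
    sym   : ∀ i j → adj i j ≡ adj j i
    irref : ∀ i → adj i i ≡ false
open Graph public

deg : (G : Graph) → Fin (n G) → ℕ
deg G v = countF (adj G v)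

numEdges : Graph → ℕ
numEdges G = sum (map (λ i → countF (λ j → (toℕ i <ᵇ toℕ j) ∧ adj G i j)) (allFin (n G)))

-- An orientation of G: dir u v = true means the edge uv is directed u → v.
-- Every edge gets exactly one direction; non-edges get none.
record Orientation (G : Graph) : Set where
  field
    dir      : Fin (n G) → Fin (n G) → Bool
    dir-edge : ∀ u v → dir u v ≡ true → adj G u v ≡ true
    dir-one  : ∀ u v → adj G u v ≡ true → dir u v ≡ not (dir v u)
open Orientation public

indeg : {G : Graph} → Orientation G → Fin (n G) → ℕ
indeg o v = countF (λ u → dir o u v)

data Walk⁺ {G : Graph} (o : Orientation G) : Fin (n G) → Fin (n G) → Set where
  step : ∀ {u v} → dir o u v ≡ true → Walk⁺ o u v
  _∷ʷ_ : ∀ {u v w} → dir o u v ≡ true → Walk⁺ o v w → Walk⁺ o u w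

-- acyclic: no directed cycle (equivalently no closed directed walk)
Acyclic : {G : Graph} → Orientation G → Set
Acyclic o = ∀ v → ¬ Walk⁺ o v v

TOdd : {G : Graph} → Subset (n G) → Orientation G → Set
TOdd T o = ∀ v → (Odd (indeg o v) → v ∈ T) × (v ∈ T → Odd (indeg o v))

Source : {G : Graph} → Subset (n G) → Subset (n G)
Source T = ∁ T

Sink : {G : Graph} → Subset (n G) → Subset (n G)
Sink {G} T = tabulate (λ v → if Data.Vec.lookup T v then oddᵇ (deg G v) else not (oddᵇ (deg G v)))

CondP : (G : Graph) → Subset (n G) → Set
CondP G T = Even (numEdges G + ∣ T ∣)

CondS : (G : Graph) → Subset (n G) → Set
CondS G T = (∃ λ v → v ∈ Source {G} T)
          × (∣ Source {G} T ∣ ≡ 1 → (n G ≡ 1) ⊎ (Source {G} T ≢ Sink {G} T))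

inCP : Graph → Set
inCP G = ∀ (T : Subset (n G)) → CondP G T →
         Σ (Orientation G) λ o → Acyclic o × TOdd T o

inCPS : Graph → Set
inCPS G = ∀ (T : Subset (n G)) → CondP G T → CondS G T →
          Σ (Orientation G) λ o → Acyclic o × TOdd T o

-- The cycle C_m (m = k + 3) on vertices 0..m-1:
-- i ~ j iff j ≡ i+1 (mod m) or i ≡ j+1 (mod m).
cycAdj : (k : ℕ) → Fin (suc (suc (suc k))) → Fin (suc (suc (suc k))) → Bool
cycAdj k i j = does (suc (toℕ i) % suc (suc (suc k)) ≟ toℕ j)
             ∨ does (suc (toℕ j) % suc (suc (suc k)) ≟ toℕ i)

private
  noLoop : ∀ k (a : ℕ) → a < suc (suc (suc k)) → suc a % suc (suc (suc k)) ≢ a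
  noLoop k a a<m eq with m≤n⇒m<n∨m≡n a<m
  ... | inj₁ sa<m = 1+n≢n (≡-trans (≡-sym (m<n⇒m%n≡m sa<m)) eq)
  ... | inj₂ sa≡m = lem (≡-trans (≡-sym (n%n≡0 (suc (suc (suc k))))) (≡-trans (cong (_% suc (suc (suc k))) (≡-sym sa≡m)) eq)) sa≡m
    where
    lem : 0 ≡ a → suc a ≡ suc (suc (suc k)) → ⊥
    lem refl ()

  cycSym : ∀ k i j → cycAdj k i j ≡ cycAdj k j i
  cycSym k i j = ∨-comm (does (suc (toℕ i) % suc (suc (suc k)) ≟ toℕ j))
                        (does (suc (toℕ j) % suc (suc (suc k)) ≟ toℕ i))

  cycIrr : ∀ k i → cycAdj k i i ≡ false
  cycIrr k i = h (suc (toℕ i) % suc (suc (suc k)) ≟ toℕ i)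
    where
    h : (d : Dec (suc (toℕ i) % suc (suc (suc k)) ≡ toℕ i)) → does d ∨ does d ≡ false
    h (yes eq) = ⊥-elim (noLoop k (toℕ i) (toℕ<n i) eq)
    h (no _) = refl

Cycle : (k : ℕ) → Graph
Cycle k = record { n = suc (suc (suc k)) ; adj = cycAdj k ; sym = cycSym k ; irref = cycIrr k }

{-# OPTIONS --safe #-}
module Submission where

-- Let the bit b a say that the edge {a, a+1 mod n} of Cₙ points forwards, a → a+1. Vertex a
-- then has in-degree [b (a-1)] + [¬ b a], which is odd iff b (a-1) = b a; so a T-odd orientation
-- is a cyclic bit sequence that flips exactly at the vertices outside T. Taking b a to be the
-- parity of the number of vertices ≤ a outside T closes up around the cycle because (P) makes
-- |V ∖ T| even (Cₙ has n edges). Such an orientation is acyclic unless all edges point the same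
-- way, and a vertex outside T, which (S) provides, is a place where the bits flip. Conversely
-- T = V satisfies (P), but an acyclic orientation has a vertex without in-neighbours.

open import Defs hiding (sym)
open import Algebra.Properties.CommutativeMonoid.Sum as Sum using ()
open import Data.Bool using (Bool; true; false; not; _∧_; _∨_; _xor_; if_then_else_)
open import Data.Bool.Properties
  using (¬-not; ∧-comm; ∧-distribˡ-∨; ∨-comm; not-distribˡ-xor; xor-identityʳ; xor-same)
open import Data.Empty using (⊥)
open import Data.Fin using (Fin; zero; suc; toℕ)
open import Data.Fin.Properties using (toℕ<n; pigeonhole)
open import Data.Fin.Subset using (Subset; ⊤; ∁; ∣_∣; _∈_)
open import Data.Fin.Subset.Properties using (∈⊤; x∈∁p⇒x∉p; ∣⊤∣≡n; ∣∁p∣≡n∸∣p∣; ∣p∣≤n)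
open import Data.List using (map; allFin; tabulate)
open import Data.List.Properties using (map-tabulate)
open import Data.Nat using (ℕ; zero; suc; _+_; _*_; _∸_; _%_; _<_; _≤_; _<ᵇ_; _≟_; z≤n; s≤s; s≤s⁻¹; s<s⁻¹)
open import Data.Nat.DivMod using (m<n⇒m%n≡m; n%n≡0; m%n<n)
open import Data.Nat.GeneralisedArithmetic using (fold)
open import Data.Nat.ListAction using (sum)
open import Data.Nat.Properties
  using (+-0-commutativeMonoid; +-identityʳ; +-assoc; +-comm; +-suc; *-suc; *-zeroʳ; *-identityʳ;
         *-monoʳ-≤; +-monoʳ-<; m≤m+n; m≤n+m; m∸n≤m; ∸-monoʳ-<; m+[n∸m]≡n; ≤-trans; <-trans; <-irrefl;
         n<1+n; m<n⇒m<1+n; m<1+n⇒m<n∨m≡n; <⇒≢; ≤∧≢⇒<; module ≤-Reasoning)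
open import Data.Product using (∃; _×_; _,_; proj₁; proj₂)
open import Data.Sum using (_⊎_; inj₁; inj₂)
open import Data.Vec using (Vec; []; _∷_; lookup)
open import Data.Vec.Properties using (lookup-map; []=⇒lookup; lookup⇒[]=)
open import Function using (_∘_; id; _⇔_; mk⇔; Equivalence)
import Function.Properties.Equivalence as ⇔
open import Relation.Nullary using (¬_; Dec; yes; does; contradiction)
open import Relation.Nullary.Decidable using (dec-true; dec-false; does-⇔)
open import Relation.Binary.PropositionalEquality
  using (_≡_; _≢_; refl; sym; trans; cong; cong₂; subst; module ≡-Reasoning)

open Sum +-0-commutativeMonoid using (sum-syntax; sum-cong-≗; ∑-distrib-+; sum-replicate-zero)

from-does : ∀ {P : Set} (d : Dec P) → does d ≡ true → P
from-does (yes p) _ = p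

∧-false : ∀ {x y} → (x ≡ true → y ≡ false) → x ∧ y ≡ false
∧-false {false} _ = refl
∧-false {true}  f = f refl

∧-∧-false : ∀ x y p q → x ∧ y ≡ false → (x ∧ p) ∧ (y ∧ q) ≡ false
∧-∧-false false _     _     _ _  = refl
∧-∧-false true  false true  _ _  = refl
∧-∧-false true  false false _ _  = refl
∧-∧-false true  true  _     _ ()

∨-if-∨-∧ : ∀ x y p q → (x ∧ p) ∨ (y ∧ q) ≡ true → x ∨ y ≡ true
∨-if-∨-∧ true  _     _ _ _  = refl
∨-if-∨-∧ false true  _ _ _  = refl
∨-if-∨-∧ false false _ _ ()

one-direction : ∀ x y p q → x ∨ y ≡ true → x ∧ y ≡ false →
                (x ∧ p) ∨ (y ∧ not q) ≡ not ((y ∧ q) ∨ (x ∧ not p))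
one-direction true  true  _     _     _  ()
one-direction false false _     _     () _
one-direction true  false true  _     _  _ = refl
one-direction true  false false _     _  _ = refl
one-direction false true  _     true  _  _ = refl
one-direction false true  _     false _  _ = refl

∨-∧-cases : ∀ x y p q → (x ∧ p) ∨ (y ∧ not q) ≡ true →
            (x ≡ true × p ≡ true) ⊎ (y ≡ true × q ≡ false)
∨-∧-cases true  _     true  _     _  = inj₁ (refl , refl)
∨-∧-cases true  true  false false _  = inj₂ (refl , refl)
∨-∧-cases false true  _     false _  = inj₂ (refl , refl)
∨-∧-cases true  false false _     ()
∨-∧-cases true  true  false true  ()
∨-∧-cases false true  _     true  ()
∨-∧-cases false false _     _     ()

n<ᵇ1+n : ∀ n → (n <ᵇ suc n) ≡ true
n<ᵇ1+n zero    = refl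
n<ᵇ1+n (suc n) = n<ᵇ1+n n

1+n<ᵇn : ∀ n → (suc n <ᵇ n) ≡ false
1+n<ᵇn zero    = refl
1+n<ᵇn (suc n) = 1+n<ᵇn n

𝟙 : Bool → ℕ
𝟙 b = if b then 1 else 0

count : ∀ {n} → (Fin n → Bool) → ℕ
count {n} p = ∑[ i < n ] 𝟙 (p i)

sum-map-allFin : ∀ {n} (f : Fin n → ℕ) → sum (map f (allFin n)) ≡ ∑[ i < n ] f i
sum-map-allFin f = trans (cong sum (map-tabulate id f)) (sum-tabulate f)
  where
  sum-tabulate : ∀ {n} (f : Fin n → ℕ) → sum (tabulate f) ≡ ∑[ i < n ] f i
  sum-tabulate {zero}  f = refl
  sum-tabulate {suc n} f = cong (f zero +_) (sum-tabulate (f ∘ suc))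

countF≡count : ∀ {n} (p : Fin n → Bool) → countF p ≡ count p
countF≡count p = sum-map-allFin (𝟙 ∘ p)

count-cong : ∀ {n} {p q : Fin n → Bool} → (∀ i → p i ≡ q i) → count p ≡ count q
count-cong p≗q = sum-cong-≗ (cong 𝟙 ∘ p≗q)

count-∨ : ∀ {n} (p q : Fin n → Bool) → (∀ i → p i ∧ q i ≡ false) →
          count (λ i → p i ∨ q i) ≡ count p + count q
count-∨ p q disjoint =
  trans (sum-cong-≗ (λ i → 𝟙-∨ (p i) (q i) (disjoint i))) (∑-distrib-+ (𝟙 ∘ p) (𝟙 ∘ q))
  where
  𝟙-∨ : ∀ x y → x ∧ y ≡ false → 𝟙 (x ∨ y) ≡ 𝟙 x + 𝟙 y
  𝟙-∨ true  true  ()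
  𝟙-∨ true  false _ = refl
  𝟙-∨ false y     _ = refl

count-≟ : ∀ {n q} (h : ℕ → Bool) → q < n →
          count {n} (λ j → does (q ≟ toℕ j) ∧ h (toℕ j)) ≡ 𝟙 (h q)
count-≟ {suc n} {zero}  h _         = trans (cong (𝟙 (h 0) +_) (sum-replicate-zero n)) (+-identityʳ _)
count-≟ {suc n} {suc q} h (s≤s q<n) = count-≟ (h ∘ suc) q<n

count-≢last : ∀ n → count {suc n} (λ j → not (does (n ≟ toℕ j))) ≡ n
count-≢last zero    = refl
count-≢last (suc n) = cong suc (count-≢last n)

count-witness : ∀ {n} (p : Fin n → Bool) → count p ≢ 0 → ∃ λ i → p i ≡ true
count-witness {zero}  p count≢0 = contradiction refl count≢0
count-witness {suc n} p count≢0 with p zero in p₀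
... | true  = zero , p₀
... | false with count-witness (p ∘ suc) count≢0
...   | i , pᵢ = suc i , pᵢ

∣p∣+∣∁p∣≡n : ∀ {n} (p : Subset n) → ∣ p ∣ + ∣ ∁ p ∣ ≡ n
∣p∣+∣∁p∣≡n p = trans (cong (∣ p ∣ +_) (∣∁p∣≡n∸∣p∣ p)) (m+[n∸m]≡n (∣p∣≤n p))

countUpTo : ∀ {n} → Vec Bool n → ℕ → ℕ
countUpTo []       _       = 0
countUpTo (x ∷ xs) zero    = 𝟙 x
countUpTo (x ∷ xs) (suc a) = 𝟙 x + countUpTo xs a

countUpTo-suc : ∀ {n} (xs : Vec Bool (suc n)) (i : Fin n) →
                countUpTo xs (suc (toℕ i)) ≡ countUpTo xs (toℕ i) + 𝟙 (lookup xs (suc i))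
countUpTo-suc (x ∷ y ∷ ys) zero    = refl
countUpTo-suc (x ∷ xs)     (suc i) =
  trans (cong (𝟙 x +_) (countUpTo-suc xs i)) (sym (+-assoc (𝟙 x) _ _))

countUpTo-last : ∀ {n} (xs : Vec Bool (suc n)) → countUpTo xs n ≡ ∣ xs ∣
countUpTo-last (true  ∷ [])         = refl
countUpTo-last (false ∷ [])         = refl
countUpTo-last (true  ∷ xs@(_ ∷ _)) = cong suc (countUpTo-last xs)
countUpTo-last (false ∷ xs@(_ ∷ _)) = countUpTo-last xs

oddᵇ-suc : ∀ n → oddᵇ (suc n) ≡ not (oddᵇ n)
oddᵇ-suc zero          = refl
oddᵇ-suc (suc zero)    = refl
oddᵇ-suc (suc (suc n)) = oddᵇ-suc n

oddᵇ-+ : ∀ m n → oddᵇ (m + n) ≡ oddᵇ m xor oddᵇ n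
oddᵇ-+ zero    n = refl
oddᵇ-+ (suc m) n = begin
  oddᵇ (suc (m + n))       ≡⟨ oddᵇ-suc (m + n) ⟩
  not (oddᵇ (m + n))       ≡⟨ cong not (oddᵇ-+ m n) ⟩
  not (oddᵇ m xor oddᵇ n)  ≡⟨ not-distribˡ-xor (oddᵇ m) (oddᵇ n) ⟩
  not (oddᵇ m) xor oddᵇ n  ≡⟨ cong (_xor oddᵇ n) (oddᵇ-suc m) ⟨
  oddᵇ (suc m) xor oddᵇ n  ∎
  where open ≡-Reasoning

oddᵇ-𝟙 : ∀ x → oddᵇ (𝟙 x) ≡ x
oddᵇ-𝟙 true  = refl
oddᵇ-𝟙 false = refl

oddᵇ-+-double : ∀ m n → oddᵇ (m + (n + n)) ≡ oddᵇ m
oddᵇ-+-double m n = begin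
  oddᵇ (m + (n + n))             ≡⟨ oddᵇ-+ m (n + n) ⟩
  oddᵇ m xor oddᵇ (n + n)        ≡⟨ cong (oddᵇ m xor_) (oddᵇ-+ n n) ⟩
  oddᵇ m xor (oddᵇ n xor oddᵇ n) ≡⟨ cong (oddᵇ m xor_) (xor-same (oddᵇ n)) ⟩
  oddᵇ m xor false               ≡⟨ xor-identityʳ (oddᵇ m) ⟩
  oddᵇ m                         ∎
  where open ≡-Reasoning

even⇒¬oddᵇ : ∀ {n} → Even n → oddᵇ n ≡ false
even⇒¬oddᵇ even = cong (λ r → does (r ≟ 1)) even

even-double : ∀ n → Even (n + n)
even-double zero    = refl
even-double (suc n) = trans (cong (λ r → suc r % 2) (+-suc n n)) (even-double n)

odd-𝟙+𝟙-not⇔≡ : ∀ x y → Odd (𝟙 x + 𝟙 (not y)) ⇔ x ≡ y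
odd-𝟙+𝟙-not⇔≡ true  true  = mk⇔ (λ _ → refl) (λ _ → refl)
odd-𝟙+𝟙-not⇔≡ false false = mk⇔ (λ _ → refl) (λ _ → refl)
odd-𝟙+𝟙-not⇔≡ true  false = mk⇔ (λ ()) (λ ())
odd-𝟙+𝟙-not⇔≡ false true  = mk⇔ (λ ()) (λ ())

≡-xor-not⇔ : ∀ x t → (x ≡ x xor not t) ⇔ (t ≡ true)
≡-xor-not⇔ true  true  = mk⇔ (λ _ → refl) (λ _ → refl)
≡-xor-not⇔ false true  = mk⇔ (λ _ → refl) (λ _ → refl)
≡-xor-not⇔ true  false = mk⇔ (λ ()) (λ ())
≡-xor-not⇔ false false = mk⇔ (λ ()) (λ ())

module _ {G : Graph} (o : Orientation G) where

  acyclic-if-monotone : (h : Fin (n G) → ℕ) → (∀ u v → dir o u v ≡ true → h u < h v) → Acyclic o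
  acyclic-if-monotone h mono v cycle = <-irrefl refl (increasing cycle)
    where
    increasing : ∀ {u w} → Walk⁺ o u w → h u < h w
    increasing (step u→w)   = mono _ _ u→w
    increasing (u→v ∷ʷ v⇝w) = <-trans (mono _ _ u→v) (increasing v⇝w)

  ¬acyclic-if-in-neighbours : (∀ v → ∃ λ u → dir o u v ≡ true) → Fin (n G) → ¬ Acyclic o
  ¬acyclic-if-in-neighbours in-neighbour v₀ acyclic =
    let i , j , i<j , chainᵢ≡chainⱼ = pigeonhole (n<1+n (n G)) (chain ∘ toℕ)
    in acyclic (chain (toℕ j)) (subst (Walk⁺ o (chain (toℕ j))) chainᵢ≡chainⱼ (backwards i<j))
    where
    chain : ℕ → Fin (n G)
    chain = fold v₀ (proj₁ ∘ in-neighbour)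

    backwards : ∀ {a c} → a < c → Walk⁺ o (chain c) (chain a)
    backwards {a} {suc c} a<1+c with m<1+n⇒m<n∨m≡n a<1+c
    ... | inj₁ a<c  = proj₂ (in-neighbour (chain c)) ∷ʷ backwards a<c
    ... | inj₂ refl = step (proj₂ (in-neighbour (chain c)))

  in-neighbour-if-odd : ∀ v → Odd (indeg o v) → ∃ λ u → dir o u v ≡ true
  in-neighbour-if-odd v odd = count-witness (λ u → dir o u v) λ count≡0 →
    even0 (subst Odd (trans (countF≡count (λ u → dir o u v)) count≡0) odd)
    where
    even0 : ¬ Odd 0
    even0 ()

¬inCP-if-CondP-⊤ : ∀ {G} → Fin (n G) → CondP G ⊤ → ¬ inCP G
¬inCP-if-CondP-⊤ v₀ P⊤ inCP with o , acyclic , odd ← inCP ⊤ P⊤ =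
  ¬acyclic-if-in-neighbours o (λ v → in-neighbour-if-odd o v (proj₂ (odd v) ∈⊤)) v₀ acyclic

module _ (k : ℕ) where

  m M : ℕ
  m = suc (suc (suc k))
  M = suc (suc k)

  prev : ℕ → ℕ
  prev zero    = M
  prev (suc a) = a

  prev<m : ∀ {c} → c < m → prev c < m
  prev<m {zero}  _   = n<1+n M
  prev<m {suc c} c<m = <-trans (n<1+n c) c<m

  prev-suc% : ∀ {a} → a < m → prev (suc a % m) ≡ a
  prev-suc% a<m with m<1+n⇒m<n∨m≡n a<m
  ... | inj₁ a<M  = cong prev (m<n⇒m%n≡m (s≤s a<M))
  ... | inj₂ refl = cong prev (n%n≡0 m)

  suc-prev% : ∀ {c} → c < m → suc (prev c) % m ≡ c
  suc-prev% {zero}  _   = n%n≡0 m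
  suc-prev% {suc c} c<m = m<n⇒m%n≡m c<m

  suc%≡⇔prev≡ : ∀ {a c} → a < m → c < m → (suc a % m ≡ c) ⇔ (prev c ≡ a)
  suc%≡⇔prev≡ a<m c<m = mk⇔ (λ { refl → prev-suc% a<m }) (λ { refl → suc-prev% c<m })

  prev-prev≢ : ∀ c → prev (prev c) ≢ c
  prev-prev≢ zero          = λ ()
  prev-prev≢ (suc zero)    = λ ()
  prev-prev≢ (suc (suc c)) = <⇒≢ (m<n⇒m<1+n (n<1+n c))

  prev-exclusive : ∀ a c → does (prev c ≟ a) ∧ does (prev a ≟ c) ≡ false
  prev-exclusive a c = ∧-false λ pc≡a → dec-false (prev a ≟ c) λ pa≡c →
    prev-prev≢ c (trans (cong prev (from-does (prev c ≟ a) pc≡a)) pa≡c)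

  cycAdj≡ : ∀ u v → cycAdj k u v ≡ does (prev (toℕ v) ≟ toℕ u) ∨ does (prev (toℕ u) ≟ toℕ v)
  cycAdj≡ u v = cong₂ _∨_ (isSucc≡ u v) (isSucc≡ v u)
    where
    isSucc≡ : ∀ u v → does (suc (toℕ u) % m ≟ toℕ v) ≡ does (prev (toℕ v) ≟ toℕ u)
    isSucc≡ u v = does-⇔ (suc%≡⇔prev≡ (toℕ<n u) (toℕ<n v))
                         (suc (toℕ u) % m ≟ toℕ v) (prev (toℕ v) ≟ toℕ u)

  count-neighbours : ∀ {c} → c < m → (g h : ℕ → Bool) →
    count {m} (λ u → (does (prev c ≟ toℕ u) ∧ g (toℕ u)) ∨ (does (prev (toℕ u) ≟ c) ∧ h (toℕ u)))
      ≡ 𝟙 (g (prev c)) + 𝟙 (h (suc c % m))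
  count-neighbours {c} c<m g h = begin
    count (λ u → P u ∨ S u)               ≡⟨ count-∨ P S disjoint ⟩
    count P + count S                     ≡⟨ cong (count P +_) (count-cong S≡S′) ⟩
    count P + count S′                    ≡⟨ cong₂ _+_ (count-≟ g (prev<m c<m))
                                                       (count-≟ h (m%n<n (suc c) m)) ⟩
    𝟙 (g (prev c)) + 𝟙 (h (suc c % m))    ∎
    where
    open ≡-Reasoning
    P S S′ : Fin m → Bool
    P u  = does (prev c ≟ toℕ u) ∧ g (toℕ u)
    S u  = does (prev (toℕ u) ≟ c) ∧ h (toℕ u)
    S′ u = does (suc c % m ≟ toℕ u) ∧ h (toℕ u)
    disjoint : ∀ u → P u ∧ S u ≡ false
    disjoint u = ∧-∧-false (does (prev c ≟ toℕ u)) (does (prev (toℕ u) ≟ c)) (g (toℕ u)) (h (toℕ u))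
                           (prev-exclusive (toℕ u) c)
    S≡S′ : ∀ u → S u ≡ S′ u
    S≡S′ u = cong (_∧ h (toℕ u)) (does-⇔ (⇔.sym (suc%≡⇔prev≡ c<m (toℕ<n u)))
                                         (prev (toℕ u) ≟ c) (suc c % m ≟ toℕ u))

  <ᵇ-prev : ∀ a → (a <ᵇ prev a) ≡ does (0 ≟ a)
  <ᵇ-prev zero    = refl
  <ᵇ-prev (suc a) = 1+n<ᵇn a

  <ᵇ-suc% : ∀ {a} → a < m → (a <ᵇ suc a % m) ≡ not (does (M ≟ a))
  <ᵇ-suc% {a} a<m with m<1+n⇒m<n∨m≡n a<m
  ... | inj₁ a<M  = begin
    a <ᵇ suc a % m      ≡⟨ cong (a <ᵇ_) (m<n⇒m%n≡m (s≤s a<M)) ⟩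
    a <ᵇ suc a          ≡⟨ n<ᵇ1+n a ⟩
    true                ≡⟨ cong not (dec-false (M ≟ a) (<⇒≢ a<M ∘ sym)) ⟨
    not (does (M ≟ a))  ∎
    where open ≡-Reasoning
  ... | inj₂ refl = begin
    M <ᵇ suc M % m      ≡⟨ cong (M <ᵇ_) (n%n≡0 m) ⟩
    false               ≡⟨ cong not (dec-true (M ≟ M) refl) ⟨
    not (does (M ≟ M))  ∎
    where open ≡-Reasoning

  numEdges-Cycle : numEdges (Cycle k) ≡ m
  numEdges-Cycle = begin
    numEdges (Cycle k)
      ≡⟨ sum-map-allFin laterDegree ⟩
    ∑[ i < m ] laterDegree i
      ≡⟨ sum-cong-≗ laterDegree≡ ⟩
    ∑[ i < m ] (𝟙 (does (0 ≟ toℕ i)) + 𝟙 (not (does (M ≟ toℕ i))))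
      ≡⟨ ∑-distrib-+ {m} (λ i → 𝟙 (does (0 ≟ toℕ i))) (λ i → 𝟙 (not (does (M ≟ toℕ i)))) ⟩
    count {m} (λ i → does (0 ≟ toℕ i)) + count {m} (λ i → not (does (M ≟ toℕ i)))
      ≡⟨ cong₂ _+_ (cong suc (sum-replicate-zero M)) (count-≢last M) ⟩
    1 + M
      ∎
    where
    open ≡-Reasoning
    laterDegree : Fin m → ℕ
    laterDegree i = countF (λ j → (toℕ i <ᵇ toℕ j) ∧ cycAdj k i j)

    laterDegree≡ : ∀ i → laterDegree i ≡ 𝟙 (does (0 ≟ toℕ i)) + 𝟙 (not (does (M ≟ toℕ i)))
    laterDegree≡ i = begin
      laterDegree i
        ≡⟨ countF≡count (λ j → (a <ᵇ toℕ j) ∧ cycAdj k i j) ⟩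
      count {m} (λ j → (a <ᵇ toℕ j) ∧ cycAdj k i j)
        ≡⟨ count-cong split ⟩
      count {m} (λ j → (does (prev a ≟ toℕ j) ∧ (a <ᵇ toℕ j)) ∨ (does (prev (toℕ j) ≟ a) ∧ (a <ᵇ toℕ j)))
        ≡⟨ count-neighbours (toℕ<n i) (a <ᵇ_) (a <ᵇ_) ⟩
      𝟙 (a <ᵇ prev a) + 𝟙 (a <ᵇ suc a % m)
        ≡⟨ cong₂ (λ x y → 𝟙 x + 𝟙 y) (<ᵇ-prev a) (<ᵇ-suc% (toℕ<n i)) ⟩
      𝟙 (does (0 ≟ a)) + 𝟙 (not (does (M ≟ a)))
        ∎
      where
      a : ℕ
      a = toℕ i
      split : ∀ j → (a <ᵇ toℕ j) ∧ cycAdj k i j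
                  ≡ (does (prev a ≟ toℕ j) ∧ (a <ᵇ toℕ j)) ∨ (does (prev (toℕ j) ≟ a) ∧ (a <ᵇ toℕ j))
      split j = begin
        z ∧ cycAdj k i j   ≡⟨ cong (z ∧_) (cycAdj≡ i j) ⟩
        z ∧ (x ∨ y)        ≡⟨ ∧-distribˡ-∨ z x y ⟩
        (z ∧ x) ∨ (z ∧ y)  ≡⟨ ∨-comm (z ∧ x) (z ∧ y) ⟩
        (z ∧ y) ∨ (z ∧ x)  ≡⟨ cong₂ _∨_ (∧-comm z y) (∧-comm z x) ⟩
        (y ∧ z) ∨ (x ∧ z)  ∎
        where
        x y z : Bool
        x = does (prev (toℕ j) ≟ a)
        y = does (prev a ≟ toℕ j)
        z = a <ᵇ toℕ j

  -- b a says that the edge {a, a + 1 mod m} is directed a → a + 1.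
  module _ (b : ℕ → Bool) where

    arc : ℕ → ℕ → Bool
    arc a c = (does (prev c ≟ a) ∧ b a) ∨ (does (prev a ≟ c) ∧ not (b c))

    orientation : Orientation (Cycle k)
    orientation = record
      { dir      = λ u v → arc (toℕ u) (toℕ v)
      ; dir-edge = λ u v u→v → trans (cycAdj≡ u v) (∨-if-∨-∧ (forward u v) (forward v u) _ _ u→v)
      ; dir-one  = λ u v u~v → one-direction (forward u v) (forward v u) (b (toℕ u)) (b (toℕ v))
                                 (trans (sym (cycAdj≡ u v)) u~v) (prev-exclusive (toℕ u) (toℕ v))
      }
      where
      forward : Fin m → Fin m → Bool
      forward u v = does (prev (toℕ v) ≟ toℕ u)

    indeg-orientation : ∀ v → indeg orientation v ≡ 𝟙 (b (prev (toℕ v))) + 𝟙 (not (b (toℕ v)))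
    indeg-orientation v = trans (countF≡count {m} (λ u → arc (toℕ u) (toℕ v)))
                                (count-neighbours (toℕ<n v) b (λ _ → not (b (toℕ v))))

    TOdd-if-flips-outside : (T : Subset m) →
                            (∀ v → b (toℕ v) ≡ b (prev (toℕ v)) xor not (lookup T v)) →
                            TOdd T orientation
    TOdd-if-flips-outside T flip v = Equivalence.to odd⇔∈ , Equivalence.from odd⇔∈
      where
      x t : Bool
      x = b (prev (toℕ v))
      t = lookup T v
      indeg≡ : indeg orientation v ≡ 𝟙 x + 𝟙 (not (x xor not t))
      indeg≡ = trans (indeg-orientation v) (cong (λ y → 𝟙 x + 𝟙 (not y)) (flip v))
      odd⇔∈ : Odd (indeg orientation v) ⇔ v ∈ T
      odd⇔∈ = subst (λ d → Odd d ⇔ v ∈ T) (sym indeg≡)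
                (⇔.trans (odd-𝟙+𝟙-not⇔≡ x (x xor not t))
                (⇔.trans (≡-xor-not⇔ x t) (mk⇔ (lookup⇒[]= v T) []=⇒lookup)))

    forwardBefore : ℕ → ℕ
    forwardBefore zero    = 0
    forwardBefore (suc a) = 𝟙 (b a) + forwardBefore a

    forwardBefore-pos : ∀ {j a} → j < a → b j ≡ true → 1 ≤ forwardBefore a
    forwardBefore-pos {j} {suc a} j<1+a bⱼ with m<1+n⇒m<n∨m≡n j<1+a
    ... | inj₁ j<a  = ≤-trans (forwardBefore-pos j<a bⱼ) (m≤n+m (forwardBefore a) (𝟙 (b a)))
    ... | inj₂ refl = subst (λ z → 1 ≤ 𝟙 z + forwardBefore a) (sym bⱼ) (s≤s z≤n)

    -- Since M ∸ a < m, this orders vertices by the number of forward edges before them and then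
    -- by decreasing position.
    height : ℕ → ℕ
    height a = m * forwardBefore a + (M ∸ a)

    height-forward : ∀ {a} → b a ≡ true → height a < height (suc a)
    height-forward {a} bₐ = begin-strict
      m * f + (M ∸ a)          <⟨ +-monoʳ-< (m * f) (s≤s (m∸n≤m M a)) ⟩
      m * f + m                ≡⟨ +-comm (m * f) m ⟩
      m + m * f                ≡⟨ *-suc m f ⟨
      m * suc f                ≤⟨ m≤m+n (m * suc f) (M ∸ suc a) ⟩
      m * suc f + (M ∸ suc a)  ≡⟨ cong (λ z → m * (𝟙 z + f) + (M ∸ suc a)) bₐ ⟨
      height (suc a)           ∎
      where
      open ≤-Reasoning
      f : ℕ
      f = forwardBefore a

    height-backward : ∀ {c} → c < M → b c ≡ false → height (suc c) < height c
    height-backward {c} c<M b꜀ = begin-strict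
      height (suc c)           ≡⟨ cong (λ z → m * (𝟙 z + f) + (M ∸ suc c)) b꜀ ⟩
      m * f + (M ∸ suc c)      <⟨ +-monoʳ-< (m * f) (∸-monoʳ-< (n<1+n c) c<M) ⟩
      height c                 ∎
      where
      open ≤-Reasoning
      f : ℕ
      f = forwardBefore c

    height-wrap : 1 ≤ forwardBefore M → height 0 < height M
    height-wrap f≥1 = begin-strict
      m * 0 + M                ≡⟨ cong (_+ M) (*-zeroʳ m) ⟩
      M                        <⟨ n<1+n M ⟩
      m                        ≡⟨ *-identityʳ m ⟨
      m * 1                    ≤⟨ *-monoʳ-≤ m f≥1 ⟩
      m * forwardBefore M      ≤⟨ m≤m+n (m * forwardBefore M) (M ∸ M) ⟩
      height M                 ∎
      where open ≤-Reasoning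

    arc-cases : ∀ {a c} → arc a c ≡ true → (prev c ≡ a × b a ≡ true) ⊎ (prev a ≡ c × b c ≡ false)
    arc-cases {a} {c} a→c with ∨-∧-cases (does (prev c ≟ a)) (does (prev a ≟ c)) (b a) (b c) a→c
    ... | inj₁ (pc≡a , bₐ) = inj₁ (from-does (prev c ≟ a) pc≡a , bₐ)
    ... | inj₂ (pa≡c , b꜀) = inj₂ (from-does (prev a ≟ c) pa≡c , b꜀)

    height-increases : b M ≡ false → 1 ≤ forwardBefore M → ∀ a c → a < m →
                       (prev c ≡ a × b a ≡ true) ⊎ (prev a ≡ c × b c ≡ false) → height a < height c
    height-increases bM _   _       zero     _   (inj₁ (refl , bM≡true)) =
      contradiction (trans (sym bM) bM≡true) λ ()
    height-increases _  _   a       (suc .a) _   (inj₁ (refl , bₐ)) = height-forward bₐ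
    height-increases _  f≥1 zero    _        _   (inj₂ (refl , _))  = height-wrap f≥1
    height-increases _  _   (suc a) .a       a<m (inj₂ (refl , bₐ)) = height-backward (s<s⁻¹ a<m) bₐ

    acyclic-if-forward : b M ≡ false → ∀ {j} → j < m → b j ≡ true → Acyclic orientation
    acyclic-if-forward bM j<m bⱼ = acyclic-if-monotone orientation (height ∘ toℕ) λ u v u→v →
      height-increases bM (forwardBefore-pos j<M bⱼ) (toℕ u) (toℕ v) (toℕ<n u) (arc-cases u→v)
      where
      j<M : _ < M
      j<M = ≤∧≢⇒< (s≤s⁻¹ j<m) λ { refl → contradiction (trans (sym bM) bⱼ) λ () }

    acyclic : b M ≡ false → ∀ {a} → a < m → b (prev a) ≢ b a → Acyclic orientation
    acyclic bM {a} a<m change with b a in bₐ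
    ... | true  = acyclic-if-forward bM a<m bₐ
    ... | false = acyclic-if-forward bM (prev<m a<m) (¬-not change)

  parityOutside : Subset m → ℕ → Bool
  parityOutside T a = oddᵇ (countUpTo (∁ T) a)

  parityOutside-last : ∀ T → CondP (Cycle k) T → parityOutside T M ≡ false
  parityOutside-last T P = begin
    oddᵇ (countUpTo (∁ T) M)            ≡⟨ cong oddᵇ (countUpTo-last (∁ T)) ⟩
    oddᵇ outside                        ≡⟨ oddᵇ-+-double outside inside ⟨
    oddᵇ (outside + (inside + inside))  ≡⟨ cong oddᵇ rearrange ⟩
    oddᵇ (numEdges (Cycle k) + inside)  ≡⟨ even⇒¬oddᵇ {numEdges (Cycle k) + inside} P ⟩
    false                               ∎
    where
    open ≡-Reasoning
    inside outside : ℕ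
    inside  = ∣ T ∣
    outside = ∣ ∁ T ∣
    rearrange : outside + (inside + inside) ≡ numEdges (Cycle k) + inside
    rearrange = begin
      outside + (inside + inside)  ≡⟨ +-assoc outside inside inside ⟨
      outside + inside + inside    ≡⟨ cong (_+ inside) (+-comm outside inside) ⟩
      inside + outside + inside    ≡⟨ cong (_+ inside) (trans (∣p∣+∣∁p∣≡n T) (sym numEdges-Cycle)) ⟩
      numEdges (Cycle k) + inside  ∎

  parityOutside-step : ∀ T → parityOutside T M ≡ false →
                       ∀ v → parityOutside T (toℕ v) ≡ parityOutside T (prev (toℕ v)) xor not (lookup T v)
  parityOutside-step (t ∷ ts) last zero    = trans (oddᵇ-𝟙 (not t)) (cong (_xor not t) (sym last))
  parityOutside-step T@(t ∷ ts) _ (suc i) = begin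
    oddᵇ (countUpTo (∁ T) (suc (toℕ i)))                       ≡⟨ cong oddᵇ (countUpTo-suc (∁ T) i) ⟩
    oddᵇ (countUpTo (∁ T) (toℕ i) + 𝟙 (lookup (∁ T) (suc i)))  ≡⟨ oddᵇ-+ (countUpTo (∁ T) (toℕ i)) _ ⟩
    before xor oddᵇ (𝟙 (lookup (∁ T) (suc i)))                 ≡⟨ cong (before xor_) (oddᵇ-𝟙 _) ⟩
    before xor lookup (∁ T) (suc i)                            ≡⟨ cong (before xor_) (lookup-map i not ts) ⟩
    before xor not (lookup ts i)                               ∎
    where
    open ≡-Reasoning
    before : Bool
    before = parityOutside T (toℕ i)

  inCPS-Cycle : inCPS (Cycle k)
  inCPS-Cycle T P ((v , v∈∁T) , _) =
    orientation b , acyclic b bM (toℕ<n v) flips-at-v , TOdd-if-flips-outside b T flip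
    where
    b : ℕ → Bool
    b = parityOutside T
    bM : b M ≡ false
    bM = parityOutside-last T P
    flip : ∀ v → b (toℕ v) ≡ b (prev (toℕ v)) xor not (lookup T v)
    flip = parityOutside-step T bM
    flips-at-v : b (prev (toℕ v)) ≢ b (toℕ v)
    flips-at-v same =
      x∈∁p⇒x∉p v∈∁T (lookup⇒[]= v T (Equivalence.to (≡-xor-not⇔ _ _) (trans same (flip v))))

  ¬inCP-Cycle : ¬ inCP (Cycle k)
  ¬inCP-Cycle =
    ¬inCP-if-CondP-⊤ zero (subst Even (sym (cong₂ _+_ numEdges-Cycle (∣⊤∣≡n m))) (even-double m))

lemma6 : ∀ (k : ℕ) → inCPS (Cycle k) × ¬ inCP (Cycle k)
lemma6 k = inCPS-Cycle k , ¬inCP-Cycle k
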